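{- (1) For every sort $s\in\{\star,\Box\}$ and every term $T$, if $T\le s$ or $s\le T$ then $T\to^* s$. (2) For every kind $K$ and every term $T$, if $T\le K$ or $K\le T$ then $T\to^*T'$ for some kind $T'$.
   Context: Sorts: $\mathcal S=\{\star,\Box\}$. Let $\mathcal X$ be a set of variables and $\mathcal F$ a set of symbols; a set $\mathcal R$ of rewrite rules is given, a symbol is defined if it heads the left-hand side of some rule and constant otherwise; $\mathcal{CF}^\Box$ denotes the constant symbols of sort $\Box$. Size expressions form a first-order term algebra $\mathcal A$ over size symbols and size variables, with a quasi-ordering $\le_{\mathcal A}$. Terms: $t::= s\mid x\mid C^a\mid f\mid [x:t]t\mid (x:t)t\mid tt$ with $s\in\mathcal S$, $C\in\mathcal{CF}^\Box$, $a\in\mathcal A$, $f\in\mathcal F\setminus\mathcal{CF}^\Box$. Kinds are the terms generated by $K::=\star\mid (x:t)K$ with $t$ an arbitrary term. The reduction $\to$ is $\beta\cup\mathcal R$ closed under contexts and is assumed confluent; $\to^*$ is its reflexive-transitive closure and $T\downarrow U$ means $T$ and $U$ have a common reduct. Subtyping $\le$ is the smallest relation closed under: (refl) $T\le T$; (size) $C^a\vec t\le C^b\vec t$ when $C\in\mathcal{CF}^\Box$ and $a\le_{\mathcal A}b$; (prod) from $U'\le U$ and $V\le V'$ infer $(x:U)V\le(x:U')V'$; (conv) from $T'\le U'$, $T\downarrow T'$, $U'\downarrow U$ infer $T\le U$; (trans) from $T\le U$, $U\le V$ infer $T\le V$. -}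

module Defs where

open import Data.Nat using (ℕ; zero; suc)
open import Data.List using (List; foldl)
open import Data.Vec using (Vec)
open import Data.Product using (∃; _×_)

data Sort : Set where
  ⋆ □ : Sort

data SizeExpr (SS : Set) (ar : SS → ℕ) : Set where
  svar : ℕ → SizeExpr SS ar
  sapp : (f : SS) → Vec (SizeExpr SS ar) (ar f) → SizeExpr SS ar

-- The calculus, parameterised by
--   F  : symbols of F \ CF^□  (used as plain symbols f)
--   C  : the constant symbols of sort □ (CF^□), used annotated C^a
--   SS, ar : size symbols and their arities.
-- Variables are de Bruijn indices.
module Calculus (F C SS : Set) (ar : SS → ℕ) where

  Size : Set
  Size = SizeExpr SS ar

  data Term : Set where
    srt : Sort → Term
    var : ℕ → Term
    con : C → Size → Term
    fun : F → Term
    lam : Term → Term → Term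
    pi  : Term → Term → Term
    app : Term → Term → Term

  apps : Term → List Term → Term
  apps = foldl app

  ext : (ℕ → ℕ) → ℕ → ℕ
  ext ρ zero    = zero
  ext ρ (suc n) = suc (ρ n)

  rename : (ℕ → ℕ) → Term → Term
  rename ρ (srt s)   = srt s
  rename ρ (var x)   = var (ρ x)
  rename ρ (con c a) = con c a
  rename ρ (fun f)   = fun f
  rename ρ (lam T u) = lam (rename ρ T) (rename (ext ρ) u)
  rename ρ (pi T U)  = pi (rename ρ T) (rename (ext ρ) U)
  rename ρ (app t u) = app (rename ρ t) (rename ρ u)

  exts : (ℕ → Term) → ℕ → Term
  exts σ zero    = var zero
  exts σ (suc n) = rename suc (σ n)

  subst : (ℕ → Term) → Term → Term
  subst σ (srt s)   = srt s
  subst σ (var x)   = σ x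
  subst σ (con c a) = con c a
  subst σ (fun f)   = fun f
  subst σ (lam T u) = lam (subst σ T) (subst (exts σ) u)
  subst σ (pi T U)  = pi (subst σ T) (subst (exts σ) U)
  subst σ (app t u) = app (subst σ t) (subst σ u)

  sub0 : Term → ℕ → Term
  sub0 v zero    = v
  sub0 v (suc n) = var n

  -- A rewrite rule  f l₁ … lₙ → r  (left-hand side headed by a symbol f;
  -- such an f is then a defined symbol, so symbols of C stay constant).
  record Rule : Set where
    constructor _⟨_⟩⇒_
    field
      head : F
      args : List Term
      rhs  : Term

  lhs : Rule → Term
  lhs r = apps (fun (Rule.head r)) (Rule.args r)

  data _⊢_⟶_ (R : Rule → Set) : Term → Term → Set where
    beta  : ∀ {T u v} → R ⊢ app (lam T u) v ⟶ subst (sub0 v) u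
    rew   : ∀ {r} → R r → (σ : ℕ → Term) →
            R ⊢ subst σ (lhs r) ⟶ subst σ (Rule.rhs r)
    lamL  : ∀ {T T' u} → R ⊢ T ⟶ T' → R ⊢ lam T u ⟶ lam T' u
    lamR  : ∀ {T u u'} → R ⊢ u ⟶ u' → R ⊢ lam T u ⟶ lam T u'
    piL   : ∀ {T T' U} → R ⊢ T ⟶ T' → R ⊢ pi T U ⟶ pi T' U
    piR   : ∀ {T U U'} → R ⊢ U ⟶ U' → R ⊢ pi T U ⟶ pi T U'
    appL  : ∀ {t t' u} → R ⊢ t ⟶ t' → R ⊢ app t u ⟶ app t' u
    appR  : ∀ {t u u'} → R ⊢ u ⟶ u' → R ⊢ app t u ⟶ app t u'

  data _⊢_⟶*_ (R : Rule → Set) : Term → Term → Set where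
    ε    : ∀ {t} → R ⊢ t ⟶* t
    _◅_  : ∀ {t u v} → R ⊢ t ⟶ u → R ⊢ u ⟶* v → R ⊢ t ⟶* v

  _⊢_↓_ : (Rule → Set) → Term → Term → Set
  R ⊢ T ↓ U = ∃ λ V → (R ⊢ T ⟶* V) × (R ⊢ U ⟶* V)

  Confluent : (Rule → Set) → Set
  Confluent R = ∀ {t u v} → R ⊢ t ⟶* u → R ⊢ t ⟶* v → R ⊢ u ↓ v

  data IsKind : Term → Set where
    star : IsKind (srt ⋆)
    prod : ∀ {t K} → IsKind K → IsKind (pi t K)

  data Sub (R : Rule → Set) (_≤A_ : Size → Size → Set) : Term → Term → Set where
    refl  : ∀ {T} → Sub R _≤A_ T T
    size  : ∀ {c a b} (ts : List Term) → a ≤A b →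
            Sub R _≤A_ (apps (con c a) ts) (apps (con c b) ts)
    prod  : ∀ {U U' V V'} → Sub R _≤A_ U' U → Sub R _≤A_ V V' →
            Sub R _≤A_ (pi U V) (pi U' V')
    conv  : ∀ {T T' U U'} → Sub R _≤A_ T' U' → R ⊢ T ↓ T' → R ⊢ U' ↓ U →
            Sub R _≤A_ T U
    trans : ∀ {T U V} → Sub R _≤A_ T U → Sub R _≤A_ U V → Sub R _≤A_ T V

-- Sorts and kinds are rigid: no rewrite rule fires at their head, a sort is
-- a normal form and every reduct of a kind is a kind.  Hence, under
-- confluence, "reduces to s" and "reduces to some kind" are invariant under
-- reduction in both directions, so under conversion.  Neither holds of a
-- term headed by an annotated constant C^a (reduction keeps that head), and
-- a product never reduces to a sort, while it reduces to a kind exactly when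
-- its codomain does.  So both predicates are invariant under subtyping, and they hold
-- of s and K themselves.
module Submission where

open import Defs
open import Data.Nat using (ℕ)
open import Data.Product using (_×_; ∃; ∃₂; _,_)
open import Data.Sum using (_⊎_; inj₁; inj₂)
open import Data.List using ([]; _∷_)
open import Data.Empty using (⊥-elim)
open import Function.Base using (_∘_)
open import Function.Bundles using (_⇔_; mk⇔; Equivalence)
open import Function.Construct.Identity using (⇔-id)
open import Function.Construct.Symmetry using (⇔-sym)
open import Function.Construct.Composition using (_⇔-∘_)
open import Relation.Nullary using (¬_)
open import Relation.Binary.PropositionalEquality using (_≡_; refl)
  renaming (subst to transport)
open import Relation.Binary.Structures using (IsPreorder)

module Rigidity (F C SS : Set) (ar : SS → ℕ) where
  open Calculus F C SS ar

  data FunHeaded : Term → Set where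
    fun : ∀ {f} → FunHeaded (fun f)
    app : ∀ {t u} → FunHeaded t → FunHeaded (app t u)

  data ConHeaded : Term → Set where
    con : ∀ {c a} → ConHeaded (con c a)
    app : ∀ {t u} → ConHeaded t → ConHeaded (app t u)

  FunHeaded-apps : ∀ {t} ts → FunHeaded t → FunHeaded (apps t ts)
  FunHeaded-apps []       h = h
  FunHeaded-apps (_ ∷ ts) h = FunHeaded-apps ts (app h)

  ConHeaded-apps : ∀ {t} ts → ConHeaded t → ConHeaded (apps t ts)
  ConHeaded-apps []       h = h
  ConHeaded-apps (_ ∷ ts) h = ConHeaded-apps ts (app h)

  FunHeaded-subst : ∀ σ {t} → FunHeaded t → FunHeaded (subst σ t)
  FunHeaded-subst σ fun     = fun
  FunHeaded-subst σ (app h) = app (FunHeaded-subst σ h)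

  FunHeaded-lhs : ∀ σ r → FunHeaded (subst σ (lhs r))
  FunHeaded-lhs σ r = FunHeaded-subst σ (FunHeaded-apps (Rule.args r) fun)

  FunHeaded⇒¬ConHeaded : ∀ {t} → FunHeaded t → ¬ ConHeaded t
  FunHeaded⇒¬ConHeaded (app h) (app h′) = FunHeaded⇒¬ConHeaded h h′

  IsKind⇒¬ConHeaded : ∀ {K} → IsKind K → ¬ ConHeaded K
  IsKind⇒¬ConHeaded star     ()
  IsKind⇒¬ConHeaded (prod _) ()

  module Reduction (R : Rule → Set) where

    infixr 5 _◅◅_
    _◅◅_ : ∀ {t u v} → R ⊢ t ⟶* u → R ⊢ u ⟶* v → R ⊢ t ⟶* v
    ε       ◅◅ q = q
    (s ◅ p) ◅◅ q = s ◅ (p ◅◅ q)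

    ⟶*-piR : ∀ {U V V′} → R ⊢ V ⟶* V′ → R ⊢ pi U V ⟶* pi U V′
    ⟶*-piR ε       = ε
    ⟶*-piR (s ◅ p) = piR s ◅ ⟶*-piR p

    ConHeaded-⟶ : ∀ {t u} → R ⊢ t ⟶ u → ConHeaded t → ConHeaded u
    ConHeaded-⟶ beta          (app ())
    ConHeaded-⟶ (rew {r} _ σ) h       = ⊥-elim (FunHeaded⇒¬ConHeaded (FunHeaded-lhs σ r) h)
    ConHeaded-⟶ (appL s)      (app h) = app (ConHeaded-⟶ s h)
    ConHeaded-⟶ (appR _)      (app h) = app h

    ConHeaded-⟶* : ∀ {t u} → R ⊢ t ⟶* u → ConHeaded t → ConHeaded u
    ConHeaded-⟶* ε       h = h
    ConHeaded-⟶* (s ◅ p) h = ConHeaded-⟶* p (ConHeaded-⟶ s h)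

    -- The equation stands for the index: a redex subst σ (lhs r) cannot be
    -- matched against srt s or pi U V directly.
    srt-irreducible : ∀ {t u s} → R ⊢ t ⟶ u → ¬ t ≡ srt s
    srt-irreducible (rew {r} _ σ) eq with transport FunHeaded eq (FunHeaded-lhs σ r)
    ... | ()

    ⟶*-srt : ∀ {s u} → R ⊢ srt s ⟶* u → u ≡ srt s
    ⟶*-srt ε       = refl
    ⟶*-srt (s ◅ _) = ⊥-elim (srt-irreducible s refl)

    ⟶-pi : ∀ {t u U V} → R ⊢ t ⟶ u → t ≡ pi U V →
           ∃₂ λ U′ V′ → u ≡ pi U′ V′ × R ⊢ V ⟶* V′
    ⟶-pi (rew {r} _ σ) eq with transport FunHeaded eq (FunHeaded-lhs σ r)
    ... | ()
    ⟶-pi (piL {T' = T′} {U = V} _) refl = T′ , V , refl , ε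
    ⟶-pi (piR {T = U} {U' = V′} s) refl = U , V′ , refl , s ◅ ε

    ⟶*-pi : ∀ {U V X} → R ⊢ pi U V ⟶* X →
            ∃₂ λ U′ V′ → X ≡ pi U′ V′ × R ⊢ V ⟶* V′
    ⟶*-pi {U} {V} ε = U , V , refl , ε
    ⟶*-pi (s ◅ p) with ⟶-pi s refl
    ... | _ , _ , refl , q with ⟶*-pi p
    ...   | U″ , V″ , eq , q′ = U″ , V″ , eq , q ◅◅ q′

    IsKind-⟶* : ∀ {K K′} → IsKind K → R ⊢ K ⟶* K′ → IsKind K′
    IsKind-⟶* star     p with ⟶*-srt p
    ... | refl = star
    IsKind-⟶* (prod k) p with ⟶*-pi p
    ... | _ , _ , refl , q = prod (IsKind-⟶* k q)

    ReductionInvariant : (Term → Set) → Set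
    ReductionInvariant P = ∀ {T U} → R ⊢ T ⟶* U → P T ⇔ P U

    ↓-invariant : ∀ {P} → ReductionInvariant P → ∀ {T U} → R ⊢ T ↓ U → P T ⇔ P U
    ↓-invariant invariant (_ , p , q) = ⇔-sym (invariant q) ⇔-∘ invariant p

    module Invariance
      (_≤A_ : Size → Size → Set) (P : Term → Set)
      (reduction-invariant : ReductionInvariant P)
      (¬P-ConHeaded : ∀ {T} → ConHeaded T → ¬ P T)
      (P-pi : ∀ {U U′ V V′} → P V ⇔ P V′ → P (pi U V) → P (pi U′ V′))
      where

      Sub-invariant : ∀ {T U} → Sub R _≤A_ T U → P T ⇔ P U
      Sub-invariant refl         = ⇔-id _
      Sub-invariant (size ts _)  = mk⇔ (⊥-elim ∘ ¬P-ConHeaded (ConHeaded-apps ts con))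
                                       (⊥-elim ∘ ¬P-ConHeaded (ConHeaded-apps ts con))
      Sub-invariant (prod _ d)   = mk⇔ (P-pi (Sub-invariant d)) (P-pi (⇔-sym (Sub-invariant d)))
      Sub-invariant (conv d j k) =
        ↓-invariant reduction-invariant k ⇔-∘ (Sub-invariant d ⇔-∘ ↓-invariant reduction-invariant j)
      Sub-invariant (trans d e)  = Sub-invariant e ⇔-∘ Sub-invariant d

    HasKindReduct : Term → Set
    HasKindReduct T = ∃ λ K → IsKind K × R ⊢ T ⟶* K

    HasKindReduct-pi : ∀ {U U′ V V′} →
      (HasKindReduct V ⇔ HasKindReduct V′) → HasKindReduct (pi U V) → HasKindReduct (pi U′ V′)
    HasKindReduct-pi V⇔V′ (_ , k , q) with ⟶*-pi q
    ... | _ , _ , refl , q′ with k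
    ...   | prod k′ with Equivalence.to V⇔V′ (_ , k′ , q′)
    ...     | K , k″ , q″ = pi _ K , prod k″ , ⟶*-piR q″

    ¬HasKindReduct-ConHeaded : ∀ {T} → ConHeaded T → ¬ HasKindReduct T
    ¬HasKindReduct-ConHeaded h (_ , k , q) = IsKind⇒¬ConHeaded k (ConHeaded-⟶* q h)

    ¬⟶*-srt-ConHeaded : ∀ {s T} → ConHeaded T → ¬ R ⊢ T ⟶* srt s
    ¬⟶*-srt-ConHeaded h q with ConHeaded-⟶* q h
    ... | ()

    ¬pi-⟶*-srt : ∀ {s U V} → ¬ R ⊢ pi U V ⟶* srt s
    ¬pi-⟶*-srt q with ⟶*-pi q
    ... | _ , _ , () , _

    module _ (confluent : Confluent R) where

      ⟶*-srt-invariant : ∀ s → ReductionInvariant (λ T → R ⊢ T ⟶* srt s)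
      ⟶*-srt-invariant s {T} {U} p = mk⇔ forward (p ◅◅_)
        where
          forward : R ⊢ T ⟶* srt s → R ⊢ U ⟶* srt s
          forward q with confluent p q
          ... | _ , p′ , q′ with ⟶*-srt q′
          ...   | refl = p′

      HasKindReduct-invariant : ReductionInvariant HasKindReduct
      HasKindReduct-invariant {T} {U} p = mk⇔ forward backward
        where
          forward : HasKindReduct T → HasKindReduct U
          forward (_ , k , q) with confluent p q
          ... | K′ , p′ , q′ = K′ , IsKind-⟶* k q′ , p′
          backward : HasKindReduct U → HasKindReduct T
          backward (K , k , q) = K , k , p ◅◅ q

      ⟶*-srt-Sub-invariant : (_≤A_ : Size → Size → Set) (s : Sort) → ∀ {T U} →
        Sub R _≤A_ T U → (R ⊢ T ⟶* srt s) ⇔ (R ⊢ U ⟶* srt s)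
      ⟶*-srt-Sub-invariant _≤A_ s =
        Invariance.Sub-invariant _≤A_ (λ T → R ⊢ T ⟶* srt s) (⟶*-srt-invariant s)
          ¬⟶*-srt-ConHeaded (λ _ q → ⊥-elim (¬pi-⟶*-srt q))

      HasKindReduct-Sub-invariant : (_≤A_ : Size → Size → Set) → ∀ {T U} →
        Sub R _≤A_ T U → HasKindReduct T ⇔ HasKindReduct U
      HasKindReduct-Sub-invariant _≤A_ =
        Invariance.Sub-invariant _≤A_ HasKindReduct HasKindReduct-invariant
          ¬HasKindReduct-ConHeaded HasKindReduct-pi

mainTheorem6 : (F C SS : Set) (ar : SS → ℕ) →
    let open Calculus F C SS ar in
    (R : Rule → Set) (_≤A_ : Size → Size → Set) →
    IsPreorder _≡_ _≤A_ →
    Confluent R →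
    ((s : Sort) (T : Term) →
        Sub R _≤A_ T (srt s) ⊎ Sub R _≤A_ (srt s) T → R ⊢ T ⟶* srt s)
    ×
    ((K T : Term) → IsKind K →
        Sub R _≤A_ T K ⊎ Sub R _≤A_ K T →
        ∃ λ T' → IsKind T' × (R ⊢ T ⟶* T'))
mainTheorem6 F C SS ar R _≤A_ _ confluent = sorts , kinds
  where
    open Calculus F C SS ar
    open Rigidity F C SS ar
    open Reduction R

    sorts : (s : Sort) (T : Term) →
      Sub R _≤A_ T (srt s) ⊎ Sub R _≤A_ (srt s) T → R ⊢ T ⟶* srt s
    sorts s T (inj₁ T≤s) = Equivalence.from (⟶*-srt-Sub-invariant confluent _≤A_ s T≤s) ε
    sorts s T (inj₂ s≤T) = Equivalence.to (⟶*-srt-Sub-invariant confluent _≤A_ s s≤T) ε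

    kinds : (K T : Term) → IsKind K → Sub R _≤A_ T K ⊎ Sub R _≤A_ K T → HasKindReduct T
    kinds K T k (inj₁ T≤K) = Equivalence.from (HasKindReduct-Sub-invariant confluent _≤A_ T≤K) (K , k , ε)
    kinds K T k (inj₂ K≤T) = Equivalence.to (HasKindReduct-Sub-invariant confluent _≤A_ K≤T) (K , k , ε)
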